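{- Fix $k\ge1$. For integer weight vectors $\omega,\omega'\in\mathbb{Z}^k$ one has $P_{k,n,\omega}+P_{k,n,\omega'}=P_{k,n,\omega+\omega'}$ for every $n\ge1$. Consequently the operation $\mathfrak{F}_{k,\omega}+\mathfrak{F}_{k,\omega'}:=\mathfrak{F}_{k,\omega+\omega'}$ on the set $\{\mathfrak{F}_{k,\omega}:\omega\in\mathbb{Z}^k\}$ of weighted isobaric families is well defined, and this set is a free $\mathbb{Z}$-module under this operation.
   Context: Let $t_1,\ldots,t_k$ be indeterminates, $t^\alpha=t_1^{\alpha_1}\cdots t_k^{\alpha_k}$ for $\alpha\in\mathbb{Z}_{\ge0}^k$, $|\alpha|=\sum_i\alpha_i$, and $\alpha\vdash n$ means $\sum_i i\alpha_i=n$. Let $e_j$ be the $j$-th unit vector. For a weight vector $\omega=(\omega_1,\ldots,\omega_k)$ define $A_\omega(e_j)=\omega_j$ and, for $|\alpha|\ge2$, $A_\omega(\alpha)=\sum_{j:\alpha_j\ge1}A_\omega(\alpha-e_j)$. The weighted isobaric polynomial of level $n$ and weight $\omega$ is $P_{k,n,\omega}=\sum_{\alpha\vdash n}A_\omega(\alpha)t^\alpha$, and the weighted isobaric family of weight $\omega$ is the sequence $\mathfrak{F}_{k,\omega}=(P_{k,n,\omega})_{n\ge1}$. -}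

module Defs where

open import Data.Nat as ℕ using (ℕ; zero; suc; _∸_)
open import Data.Integer as ℤ using (ℤ; +_; 0ℤ)
open import Data.Fin as Fin using (Fin)
open import Data.Bool using (if_then_else_)
open import Relation.Nullary using (does)
open import Relation.Binary.PropositionalEquality using (_≡_)
open import Data.Nat using (_≤_)

Exp : ℕ → Set
Exp k = Fin k → ℕ

Weight : ℕ → Set
Weight k = Fin k → ℤ

sumℕ : ∀ {k} → (Fin k → ℕ) → ℕ
sumℕ {zero}  f = 0
sumℕ {suc k} f = f Fin.zero ℕ.+ sumℕ (λ i → f (Fin.suc i))

sumℤ : ∀ {k} → (Fin k → ℤ) → ℤ
sumℤ {zero}  f = 0ℤ
sumℤ {suc k} f = f Fin.zero ℤ.+ sumℤ (λ i → f (Fin.suc i))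

∣_∣ₑ : ∀ {k} → Exp k → ℕ
∣ α ∣ₑ = sumℕ α

-- isobaric level: Σ_i i α_i (variables 1-indexed: t_{j+1} ↔ Fin index j)
level : ∀ {k} → Exp k → ℕ
level α = sumℕ (λ i → suc (Fin.toℕ i) ℕ.* α i)

minusUnit : ∀ {k} → Exp k → Fin k → Exp k
minusUnit α j i = if does (i Fin.≟ j) then α i ∸ 1 else α i

-- A_ω(α), computed by recursion on the fuel m = |α|.
-- For |α| = 1, α = e_j and Σ_i α_i ω_i = ω_j.
-- For |α| ≥ 2, A_ω(α) = Σ_{j : α_j ≥ 1} A_ω(α - e_j).
-- (A_ω(0) is not used: it is never a monomial of level n ≥ 1; we set it to 0.)
-- [α_j ≥ 1] · x
guard : ℕ → ℤ → ℤ
guard zero    x = 0ℤ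
guard (suc _) x = x

Aaux : ∀ {k} → Weight k → ℕ → Exp k → ℤ
Aaux ω zero α = 0ℤ
Aaux ω (suc zero) α = sumℤ (λ i → + (α i) ℤ.* ω i)
Aaux ω (suc (suc m)) α = sumℤ (λ j → guard (α j) (Aaux ω (suc m) (minusUnit α j)))

A : ∀ {k} → Weight k → Exp k → ℤ
A ω α = Aaux ω ∣ α ∣ₑ α

-- P_{k,n,ω}, as its coefficient function: coefficient of t^α is A_ω(α) if α ⊢ n, else 0.
P : (k n : ℕ) → Weight k → Exp k → ℤ
P k n ω α = if does (level α ℕ.≟ n) then A ω α else 0ℤ

_+ʷ_ : ∀ {k} → Weight k → Weight k → Weight k
(ω +ʷ ω') i = ω i ℤ.+ ω' i

_·ʷ_ : ∀ {k} → ℤ → Weight k → Weight k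
(c ·ʷ ω) i = c ℤ.* ω i

0ʷ : ∀ {k} → Weight k
0ʷ i = 0ℤ

lincomb : ∀ {k m} → (Fin m → ℤ) → (Fin m → Weight k) → Weight k
lincomb {m = zero}  c β = 0ʷ
lincomb {m = suc m} c β = (c Fin.zero ·ʷ β Fin.zero) +ʷ lincomb (λ i → c (Fin.suc i)) (λ i → β (Fin.suc i))

-- Equality of the families 𝔉_{k,ω} and 𝔉_{k,ω'}: P_{k,n,ω} = P_{k,n,ω'} (coefficientwise) for all n ≥ 1.
_≈𝔉_ : ∀ {k} → Weight k → Weight k → Set
_≈𝔉_ {k} ω ω' = ∀ (n : ℕ) → 1 ≤ n → ∀ (α : Exp k) → P k n ω α ≡ P k n ω' α

{-# OPTIONS --safe #-}
module Submission where

-- A_ω(α) is ℤ-linear in ω: for |α| = 1 it is Σ α_i ω_i, and each recursive step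
-- is a sum of earlier values. Hence P_{k,n,ω} is additive in ω, which makes the
-- addition of families well defined. Conversely 𝔉_ω determines ω, since the
-- coefficient of t_i in P_{k,i,ω} is A_ω(e_i) = ω_i. So ω ↦ 𝔉_ω identifies ℤ^k
-- with the set of families, and the unit weights are a basis.

open import Defs
open import Algebra.Bundles using (Monoid)
import Algebra.Properties.Monoid.Sum as MonoidSum
import Algebra.Properties.CommutativeSemigroup as CommSemigroup
open import Data.Bool using (true; false; if_then_else_)
open import Data.Fin using (Fin; toℕ; _≟_; zero; suc)
import Data.Fin.Properties as Fin
open import Data.Integer as ℤ using (ℤ; _+_; _*_; +_; 0ℤ)
import Data.Integer.Properties as ℤ
open import Data.Nat as ℕ using (ℕ; _≤_; zero; suc; s≤s; z≤n)
import Data.Nat.Properties as ℕ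
open import Data.Product using (Σ; _×_; _,_)
open import Data.Vec.Functional using (Vector)
open import Function using (_∘_)
open import Relation.Nullary.Decidable using (does; dec-true; dec-false)
open import Relation.Binary.PropositionalEquality
  using (_≡_; _≢_; _≗_; refl; sym; trans; cong; cong₂)
open Relation.Binary.PropositionalEquality.≡-Reasoning

module _ {a ℓ} (M : Monoid a ℓ) where
  open Monoid M using (Carrier; _≈_; _∙_; ε; ∙-cong; ∙-congˡ; identityˡ; identityʳ)
    renaming (trans to ≈-trans)
  open MonoidSum M using (sum; sum-cong-≋; sum-replicate-zero)

  sum-concentrated : ∀ {k} (f : Vector Carrier k) (i : Fin k) →
                     (∀ j → j ≢ i → f j ≈ ε) → sum f ≈ f i
  sum-concentrated {suc k} f zero off =
    ≈-trans (∙-congˡ (≈-trans (sum-cong-≋ (λ j → off (suc j) λ ())) (sum-replicate-zero k)))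
            (identityʳ (f zero))
  sum-concentrated {suc k} f (suc i) off =
    ≈-trans (∙-cong (off zero λ ())
                    (sum-concentrated (f ∘ suc) i (λ j j≢i → off (suc j) (j≢i ∘ Fin.suc-injective))))
            (identityˡ (f (suc i)))

sumℕ≡sum : ∀ {k} (f : Fin k → ℕ) → sumℕ f ≡ MonoidSum.sum ℕ.+-0-monoid f
sumℕ≡sum {zero}  f = refl
sumℕ≡sum {suc k} f = cong (f zero ℕ.+_) (sumℕ≡sum (f ∘ suc))

sumℤ≡sum : ∀ {k} (f : Fin k → ℤ) → sumℤ f ≡ MonoidSum.sum ℤ.+-0-monoid f
sumℤ≡sum {zero}  f = refl
sumℤ≡sum {suc k} f = cong (_+_ (f zero)) (sumℤ≡sum (f ∘ suc))

sumℕ-concentrated : ∀ {k} (f : Fin k → ℕ) (i : Fin k) → (∀ j → j ≢ i → f j ≡ 0) → sumℕ f ≡ f i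
sumℕ-concentrated f i off = trans (sumℕ≡sum f) (sum-concentrated ℕ.+-0-monoid f i off)

sumℤ-concentrated : ∀ {k} (f : Fin k → ℤ) (i : Fin k) → (∀ j → j ≢ i → f j ≡ 0ℤ) → sumℤ f ≡ f i
sumℤ-concentrated f i off = trans (sumℤ≡sum f) (sum-concentrated ℤ.+-0-monoid f i off)

sumℤ-cong : ∀ {k} {f g : Fin k → ℤ} → f ≗ g → sumℤ f ≡ sumℤ g
sumℤ-cong {zero}  f≗g = refl
sumℤ-cong {suc k} f≗g = cong₂ _+_ (f≗g zero) (sumℤ-cong (f≗g ∘ suc))

sumℤ-merge : ∀ {k} {f g h : Fin k → ℤ} → (∀ i → f i + g i ≡ h i) → sumℤ f + sumℤ g ≡ sumℤ h
sumℤ-merge {zero}  fgh = refl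
sumℤ-merge {suc k} {f} {g} fgh =
  trans (CommSemigroup.interchange ℤ.+-commutativeSemigroup
           (f zero) (sumℤ (f ∘ suc)) (g zero) (sumℤ (g ∘ suc)))
        (cong₂ _+_ (fgh zero) (sumℤ-merge (fgh ∘ suc)))

guard-+ : ∀ a x y → guard a x + guard a y ≡ guard a (x + y)
guard-+ zero    x y = refl
guard-+ (suc a) x y = refl

Aaux-+ʷ : ∀ {k} (ω ω' : Weight k) m α → Aaux ω m α + Aaux ω' m α ≡ Aaux (ω +ʷ ω') m α
Aaux-+ʷ ω ω' zero          α = refl
Aaux-+ʷ ω ω' (suc zero)    α = sumℤ-merge (λ i → sym (ℤ.*-distribˡ-+ (+ α i) (ω i) (ω' i)))
Aaux-+ʷ ω ω' (suc (suc m)) α = sumℤ-merge λ j →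
  trans (guard-+ (α j) _ _) (cong (guard (α j)) (Aaux-+ʷ ω ω' (suc m) (minusUnit α j)))

Aaux-cong : ∀ {k} {ω ω' : Weight k} → ω ≗ ω' → ∀ m α → Aaux ω m α ≡ Aaux ω' m α
Aaux-cong ω≗ω' zero          α = refl
Aaux-cong ω≗ω' (suc zero)    α = sumℤ-cong (λ i → cong (+ α i *_) (ω≗ω' i))
Aaux-cong ω≗ω' (suc (suc m)) α = sumℤ-cong λ j →
  cong (guard (α j)) (Aaux-cong ω≗ω' (suc m) (minusUnit α j))

P-+ʷ : ∀ {k} n (ω ω' : Weight k) α → P k n ω α + P k n ω' α ≡ P k n (ω +ʷ ω') α
P-+ʷ n ω ω' α with does (level α ℕ.≟ n)
... | true  = Aaux-+ʷ ω ω' ∣ α ∣ₑ α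
... | false = refl

P-cong : ∀ {k} {ω ω' : Weight k} → ω ≗ ω' → ∀ n α → P k n ω α ≡ P k n ω' α
P-cong ω≗ω' n α with does (level α ℕ.≟ n)
... | true  = Aaux-cong ω≗ω' ∣ α ∣ₑ α
... | false = refl

P-atLevel : ∀ {k} n (ω : Weight k) α → level α ≡ n → P k n ω α ≡ A ω α
P-atLevel n ω α eq rewrite dec-true (level α ℕ.≟ n) eq = refl

+ʷ-resp-≈𝔉 : ∀ {k} {ω₁ ω₂ ω₁' ω₂' : Weight k} → ω₁ ≈𝔉 ω₂ → ω₁' ≈𝔉 ω₂' → (ω₁ +ʷ ω₁') ≈𝔉 (ω₂ +ʷ ω₂')
+ʷ-resp-≈𝔉 {ω₁ = ω₁} {ω₂} {ω₁'} {ω₂'} same same' n n≥1 α = begin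
  P _ n (ω₁ +ʷ ω₁') α       ≡⟨ P-+ʷ n ω₁ ω₁' α ⟨
  P _ n ω₁ α + P _ n ω₁' α  ≡⟨ cong₂ _+_ (same n n≥1 α) (same' n n≥1 α) ⟩
  P _ n ω₂ α + P _ n ω₂' α  ≡⟨ P-+ʷ n ω₂ ω₂' α ⟩
  P _ n (ω₂ +ʷ ω₂') α       ∎

≗⇒≈𝔉 : ∀ {k} {ω ω' : Weight k} → ω ≗ ω' → ω ≈𝔉 ω'
≗⇒≈𝔉 ω≗ω' n _ = P-cong ω≗ω' n

unit : ∀ {k} → Fin k → Exp k
unit i j = if does (i ≟ j) then 1 else 0

unit-diag : ∀ {k} (i : Fin k) → unit i i ≡ 1
unit-diag i rewrite dec-true (i ≟ i) refl = refl

unit-off : ∀ {k} {i j : Fin k} → i ≢ j → unit i j ≡ 0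
unit-off {i = i} {j} i≢j rewrite dec-false (i ≟ j) i≢j = refl

∣unit∣ : ∀ {k} (i : Fin k) → ∣ unit i ∣ₑ ≡ 1
∣unit∣ i = trans (sumℕ-concentrated (unit i) i (λ j j≢i → unit-off (j≢i ∘ sym))) (unit-diag i)

level-unit : ∀ {k} (i : Fin k) → level (unit i) ≡ suc (toℕ i)
level-unit i = trans (sumℕ-concentrated _ i off) diag
  where
  off : ∀ j → j ≢ i → suc (toℕ j) ℕ.* unit i j ≡ 0
  off j j≢i = trans (cong (suc (toℕ j) ℕ.*_) (unit-off (j≢i ∘ sym))) (ℕ.*-zeroʳ (suc (toℕ j)))
  diag : suc (toℕ i) ℕ.* unit i i ≡ suc (toℕ i)
  diag = trans (cong (suc (toℕ i) ℕ.*_) (unit-diag i)) (ℕ.*-identityʳ (suc (toℕ i)))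

A-unit : ∀ {k} (ω : Weight k) i → A ω (unit i) ≡ ω i
A-unit ω i = begin
  Aaux ω ∣ unit i ∣ₑ (unit i)         ≡⟨ cong (λ m → Aaux ω m (unit i)) (∣unit∣ i) ⟩
  sumℤ (λ j → + unit i j * ω j)       ≡⟨ sumℤ-concentrated _ i off ⟩
  + unit i i * ω i                    ≡⟨ cong (λ u → + u * ω i) (unit-diag i) ⟩
  + 1 * ω i                           ≡⟨ ℤ.*-identityˡ (ω i) ⟩
  ω i                                 ∎
  where
  off : ∀ j → j ≢ i → + unit i j * ω j ≡ 0ℤ
  off j j≢i = cong (λ u → + u * ω j) (unit-off (j≢i ∘ sym))

P-unit : ∀ {k} (ω : Weight k) i → P k (suc (toℕ i)) ω (unit i) ≡ ω i
P-unit ω i = trans (P-atLevel _ ω (unit i) (level-unit i)) (A-unit ω i)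

≈𝔉⇒≗ : ∀ {k} {ω ω' : Weight k} → ω ≈𝔉 ω' → ω ≗ ω'
≈𝔉⇒≗ {k} {ω} {ω'} same i = begin
  ω i                             ≡⟨ P-unit ω i ⟨
  P k (suc (toℕ i)) ω (unit i)    ≡⟨ same (suc (toℕ i)) (s≤s z≤n) (unit i) ⟩
  P k (suc (toℕ i)) ω' (unit i)   ≡⟨ P-unit ω' i ⟩
  ω' i                            ∎

unitʷ : ∀ {k} → Fin k → Weight k
unitʷ i j = + unit i j

lincomb-apply : ∀ {k m} (c : Fin m → ℤ) (β : Fin m → Weight k) j →
                lincomb c β j ≡ sumℤ (λ i → c i * β i j)
lincomb-apply {m = zero}  c β j = refl
lincomb-apply {m = suc m} c β j = cong (_+_ (c zero * β zero j)) (lincomb-apply (c ∘ suc) (β ∘ suc) j)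

lincomb-unitʷ : ∀ {k} (c : Fin k → ℤ) → lincomb c unitʷ ≗ c
lincomb-unitʷ c j = begin
  lincomb c unitʷ j                ≡⟨ lincomb-apply c unitʷ j ⟩
  sumℤ (λ i → c i * + unit i j)    ≡⟨ sumℤ-concentrated _ j off ⟩
  c j * + unit j j                 ≡⟨ cong (λ u → c j * + u) (unit-diag j) ⟩
  c j * + 1                        ≡⟨ ℤ.*-identityʳ (c j) ⟩
  c j                              ∎
  where
  off : ∀ i → i ≢ j → c i * + unit i j ≡ 0ℤ
  off i i≢j = trans (cong (λ u → c i * + u) (unit-off i≢j)) (ℤ.*-zeroʳ (c i))

theorem2 : (k : ℕ) → 1 ≤ k →
    -- additivity of the polynomials
    ((ω ω' : Weight k) (n : ℕ) → 1 ≤ n → (α : Exp k) →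
      P k n ω α + P k n ω' α ≡ P k n (ω +ʷ ω') α)
    ×
    -- the operation 𝔉_ω + 𝔉_ω' := 𝔉_{ω+ω'} is well defined on families
    ((ω₁ ω₂ ω₁' ω₂' : Weight k) → ω₁ ≈𝔉 ω₂ → ω₁' ≈𝔉 ω₂' →
      (ω₁ +ʷ ω₁') ≈𝔉 (ω₂ +ʷ ω₂'))
    ×
    -- the set of families is a free ℤ-module: it has a basis 𝔉_{β_1},…,𝔉_{β_m}
    (Σ ℕ λ m → Σ (Fin m → Weight k) λ β →
      -- spanning: every family is a ℤ-linear combination of the basis
      ((ω : Weight k) → Σ (Fin m → ℤ) λ c → ω ≈𝔉 lincomb c β)
      ×
      -- linear independence / uniqueness of coefficients
      ((c c' : Fin m → ℤ) → lincomb c β ≈𝔉 lincomb c' β → (i : Fin m) → c i ≡ c' i))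
theorem2 k _ =
  (λ ω ω' n _ → P-+ʷ n ω ω') ,
  (λ _ _ _ _ → +ʷ-resp-≈𝔉) ,
  (k , unitʷ , spanning , independent)
  where
  spanning : (ω : Weight k) → Σ (Fin k → ℤ) λ c → ω ≈𝔉 lincomb c unitʷ
  spanning ω = ω , ≗⇒≈𝔉 (sym ∘ lincomb-unitʷ ω)

  independent : (c c' : Fin k → ℤ) → lincomb c unitʷ ≈𝔉 lincomb c' unitʷ → c ≗ c'
  independent c c' same i = begin
    c i                 ≡⟨ lincomb-unitʷ c i ⟨
    lincomb c unitʷ i   ≡⟨ ≈𝔉⇒≗ same i ⟩
    lincomb c' unitʷ i  ≡⟨ lincomb-unitʷ c' i ⟩
    c' i                ∎
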